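{- Let $n\ge1$ and $c\ge1$ be integers. For $0\le k\le (c-1)n+c\binom{n}{2}$, $$i_c(n,k)=\sum_{j=0}^{k} i(n,j)\,p_{\le n,c-1}(k-j).$$
   Context: For integers $n\ge1$, $c\ge1$, let $G_{c,n}$ be the set of colored permutations: words $\sigma=\sigma_1^{[c_1]}\cdots\sigma_n^{[c_n]}$ where $|\sigma|=\sigma_1\cdots\sigma_n$ is a permutation of $[n]$ and each color $c_i\in\{0,\dots,c-1\}$. For a permutation $\pi$ of $[n]$, $\mathrm{inv}(\pi)=|\{(i,j):i<j,\ \pi_i>\pi_j\}|$. Let $\mathrm{col}(\sigma)=c_1+\cdots+c_n$ and $\mathrm{inv}_c(\sigma)=\mathrm{inv}(|\sigma|)+\mathrm{col}(\sigma)+c\cdot|\{(i,j):1\le i<j\le n,\ \sigma_i<\sigma_j,\ c_j\ne0\}|$. Define $i_c(n,k)=|\{\sigma\in G_{c,n}:\mathrm{inv}_c(\sigma)=k\}|$, and let $i(n,k)$ be the number of permutations of $[n]$ with exactly $k$ inversions (classical Mahonian numbers). $p_{\le i,j}(m)$ denotes the number of integer partitions of $m$ into parts of size at most $i$ in which each part appears at most $j$ times. -}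

module Defs where

open import Data.Nat using (ℕ; zero; suc; _+_; _*_; _<?_; _≟_)
open import Data.Bool using (Bool; true; false; if_then_else_)
open import Data.List using (List; []; _∷_; map; concatMap; filter; length; upTo; zip)
open import Data.Nat.ListAction using (sum)
open import Data.Product using (_×_; _,_; proj₁; proj₂)
open import Relation.Nullary using (¬?)
open import Relation.Nullary.Decidable using (⌊_⌋)
import Data.List.Relation.Unary.Unique.DecPropositional as UDec

words : {A : Set} → ℕ → List A → List (List A)
words zero    as = [] ∷ []
words (suc n) as = concatMap (λ a → map (a ∷_) (words n as)) as

[_] : ℕ → List ℕ
[ n ] = map suc (upTo n)

colors : ℕ → List ℕ
colors c = upTo c

perms : ℕ → List (List ℕ)
perms n = filter (UDec.unique? _≟_) (words n [ n ])

coloredPerms : ℕ → ℕ → List (List (ℕ × ℕ))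
coloredPerms c n =
  filter (λ w → UDec.unique? _≟_ (map proj₁ w))
         (words n (concatMap (λ a → map (a ,_) (colors c)) [ n ]))

count : {A : Set} → (A → Bool) → List A → ℕ
count p []       = 0
count p (x ∷ xs) = (if p x then 1 else 0) + count p xs

inv : List ℕ → ℕ
inv []       = 0
inv (x ∷ xs) = count (λ y → ⌊ y <? x ⌋) xs + inv xs

col : List (ℕ × ℕ) → ℕ
col w = sum (map proj₂ w)

colPairs : List (ℕ × ℕ) → ℕ
colPairs []             = 0
colPairs ((x , _) ∷ xs) =
  count (λ yc → ⌊ x <? proj₁ yc ⌋ Data.Bool.∧ ⌊ ¬? (proj₂ yc ≟ 0) ⌋) xs + colPairs xs

inv-c : ℕ → List (ℕ × ℕ) → ℕ
inv-c c w = inv (map proj₁ w) + col w + c * colPairs w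

i : ℕ → ℕ → ℕ
i n k = count (λ π → ⌊ inv π ≟ k ⌋) (perms n)

i-c : ℕ → ℕ → ℕ → ℕ
i-c c n k = count (λ σ → ⌊ inv-c c σ ≟ k ⌋) (coloredPerms c n)

-- p_{≤a,b}(m): partitions of m into parts of size ≤ a, each part used ≤ b times.
-- A partition is encoded by its multiplicity vector (m₁,…,m_a) with 0 ≤ mₜ ≤ b;
-- it is a partition of m iff Σₜ t·mₜ = m.
weight : List ℕ → ℕ
weight ms = sum (map (λ p → proj₁ p * proj₂ p) (zip [ length ms ] ms))

p≤ : ℕ → ℕ → ℕ → ℕ
p≤ a b m = count (λ ms → ⌊ weight ms ≟ m ⌋) (words a (upTo (suc b)))

sumTo : ℕ → (ℕ → ℕ) → ℕ
sumTo k f = sum (map f (upTo (suc k)))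

-- Distributions are handled as multisets: the values of a statistic on a finite list, as a list up
-- to permutation (↭).  The multiset of x + y over a product of two lists is the sumset xs ⊕ ys, and
-- the number of occurrences of k in a sumset is the convolution of the two counting functions.
--
-- Splitting off the last letter (v , d) of a c-coloured permutation of [n+1] and standardising the
-- remaining word to [n] is a bijection G_{c,n+1} ≅ G_{c,n} × ([n+1] × {0,…,c-1}), under which inv_c
-- grows by a quantity depending only on (v , d); over all letters these increments take each value
-- in {0, …, c(n+1) - 1} exactly once.  Hence inv_c has the multiset ⊕_{m ≤ n} {0, …, cm - 1} on
-- G_{c,n}.  Writing {0, …, cm - 1} = {0, …, m - 1} ⊕ {0, m, …, (c-1)m} (digits in base m) and
-- regrouping, the first factors give inv on permutations (the case c = 1) and the second ones give
-- the weights Σ t·m_t of multiplicity vectors (m_1, …, m_n) ∈ {0, …, c-1}ⁿ, i.e. the partitions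
-- counted by p_{≤n,c-1}.  Counting occurrences of k turns this sumset identity into the theorem.
module Submission where

open import Defs
open import Algebra.Bundles using (CommutativeSemigroup)
import Algebra.Properties.CommutativeSemigroup as CommutativeSemigroupProperties
open import Data.Bool using (Bool; true; false; _∧_; if_then_else_)
open import Data.Bool.Properties using (∧-zeroʳ; ∧-identityʳ)
open import Data.Empty using (⊥-elim)
open import Data.List
  using (List; []; _∷_; _++_; _∷ʳ_; map; concat; concatMap; filter; length; upTo; applyUpTo; zip;
         cartesianProduct; cartesianProductWith; initLast; _∷ʳ′_)
open import Data.List.Properties
  using (map-id; map-id-local; map-∘; map-++; map-cong; map-cong-local; map-injective; map-upTo;
         map-applyUpTo; map-concatMap; concatMap-map; concatMap-cong; concatMap-pure; length-++;
         length-map; length-upTo; upTo-∷ʳ; ++-identityʳ; ∷-injective; ∷ʳ-injective;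
         cartesianProductWith-zeroʳ; cartesianProductWith-distribʳ-++)
open import Data.List.Membership.Propositional using (_∈_; _∉_)
open import Data.List.Membership.Propositional.Properties
  using (∈-map⁺; ∈-map⁻; ∈-∃++; ∈-upTo⁺; ∈-upTo⁻; ∈-filter⁺; ∈-filter⁻; ∈-cartesianProduct⁺;
         ∈-cartesianProduct⁻; ∈-cartesianProductWith⁺; ∈-cartesianProductWith⁻)
open import Data.List.Membership.Propositional.Properties.WithK using (unique∧set⇒bag)
open import Data.List.Relation.Binary.BagAndSetEquality using (∼bag⇒↭)
open import Data.List.Relation.Binary.Permutation.Propositional
  using (_↭_; ↭-refl; ↭-sym; ↭-trans; ↭-reflexive; ↭-prep; ↭-isEquivalence; module PermutationReasoning)
import Data.List.Relation.Binary.Permutation.Propositional.Properties as ↭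
open import Data.List.Relation.Binary.Subset.Propositional using (_⊆_)
open import Data.List.Relation.Unary.All as All using (All; []; _∷_)
import Data.List.Relation.Unary.All.Properties as All
open import Data.List.Relation.Unary.Any using (here; there)
open import Data.List.Relation.Unary.Unique.Propositional using (Unique; []; _∷_)
import Data.List.Relation.Unary.Unique.Propositional.Properties as Unique
import Data.List.Relation.Unary.Unique.DecPropositional as UniqueDec
open import Data.Nat
  using (ℕ; zero; suc; pred; _+_; _*_; _∸_; _≤_; _<_; _≥_; _≟_; _≤?_; _<?_; z≤n; s≤s; z<s; s<s)
open import Data.Nat.Combinatorics using (_C_)
open import Data.Nat.ListAction using (sum)
open import Data.Nat.ListAction.Properties using (sum-++; sum-↭)
open import Data.Nat.Properties
  using (+-assoc; +-comm; +-identityʳ; +-cancelˡ-≡; *-zeroʳ; *-identityˡ; *-suc; *-comm;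
         *-distribʳ-+; m∸n+n≡m; suc-injective; ≤-refl; ≤-trans; ≤-pred; n≤1+n; +-commutativeSemigroup)
open import Data.Nat.Solver using (module +-*-Solver)
open import Data.Product using (∃; _×_; _,_; proj₁; proj₂; map₁; uncurry)
open import Function using (_∘_; _⇔_; mk⇔)
open import Relation.Binary.PropositionalEquality
  using (_≡_; _≢_; refl; sym; trans; cong; cong₂; subst; module ≡-Reasoning)
open import Relation.Nullary using (Dec; does; ¬?)
open import Relation.Nullary.Decidable using (⌊_⌋; does-⇔; isYes≗does)

open CommutativeSemigroupProperties +-commutativeSemigroup using (interchange)

-- _≟_, _<?_ and _≤?_ compute through the builtins _≡ᵇ_ and _≤ᵇ_, which are stuck on open terms,
-- so ⌊ suc m ≟ suc n ⌋ is not definitionally ⌊ m ≟ n ⌋.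
⌊⌋-⇔ : {P Q : Set} → P ⇔ Q → (p? : Dec P) (q? : Dec Q) → ⌊ p? ⌋ ≡ ⌊ q? ⌋
⌊⌋-⇔ P⇔Q p? q? = trans (isYes≗does p?) (trans (does-⇔ P⇔Q p? q?) (sym (isYes≗does q?)))

≟-suc : (m n : ℕ) → ⌊ suc m ≟ suc n ⌋ ≡ ⌊ m ≟ n ⌋
≟-suc m n = ⌊⌋-⇔ (mk⇔ suc-injective (cong suc)) (suc m ≟ suc n) (m ≟ n)

<?-suc : (m n : ℕ) → ⌊ suc m <? suc n ⌋ ≡ ⌊ m <? n ⌋
<?-suc m n = ⌊⌋-⇔ (mk⇔ ≤-pred s≤s) (suc m <? suc n) (m <? n)

≤?-suc : (m n : ℕ) → ⌊ suc m ≤? suc n ⌋ ≡ ⌊ m ≤? n ⌋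
≤?-suc m n = ⌊⌋-⇔ (mk⇔ ≤-pred s≤s) (suc m ≤? suc n) (m ≤? n)

module _ {A : Set} where

  count-++ : (p : A → Bool) (xs ys : List A) → count p (xs ++ ys) ≡ count p xs + count p ys
  count-++ p []       ys = refl
  count-++ p (x ∷ xs) ys = trans (cong (_ +_) (count-++ p xs ys)) (sym (+-assoc (if p x then 1 else 0) _ _))

  count-map : {B : Set} (p : B → Bool) (f : A → B) (xs : List A) → count p (map f xs) ≡ count (p ∘ f) xs
  count-map p f []       = refl
  count-map p f (x ∷ xs) = cong (_ +_) (count-map p f xs)

  count-cong-∈ : {p q : A → Bool} (xs : List A) → (∀ {x} → x ∈ xs → p x ≡ q x) → count p xs ≡ count q xs
  count-cong-∈ []       p≗q = refl
  count-cong-∈ (x ∷ xs) p≗q =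
    cong₂ (λ b n → (if b then 1 else 0) + n) (p≗q (here refl)) (count-cong-∈ xs (p≗q ∘ there))

  count-false : (xs : List A) → count (λ _ → false) xs ≡ 0
  count-false []       = refl
  count-false (_ ∷ xs) = count-false xs

  count-true : (xs : List A) → count (λ _ → true) xs ≡ length xs
  count-true []       = refl
  count-true (_ ∷ xs) = cong suc (count-true xs)

  count≡sum-map : (p : A → Bool) (xs : List A) → count p xs ≡ sum (map (λ x → if p x then 1 else 0) xs)
  count≡sum-map p []       = refl
  count≡sum-map p (x ∷ xs) = cong (_ +_) (count≡sum-map p xs)

  count-↭ : (p : A → Bool) {xs ys : List A} → xs ↭ ys → count p xs ≡ count p ys
  count-↭ p {xs} {ys} xs↭ys = begin
    count p xs                                ≡⟨ count≡sum-map p xs ⟩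
    sum (map (λ x → if p x then 1 else 0) xs) ≡⟨ sum-↭ (↭.map⁺ _ xs↭ys) ⟩
    sum (map (λ x → if p x then 1 else 0) ys) ≡⟨ count≡sum-map p ys ⟨
    count p ys                                ∎
    where open ≡-Reasoning

multiplicity : ℕ → List ℕ → ℕ
multiplicity k = count (λ z → ⌊ z ≟ k ⌋)

infixl 6 _⊕_

_⊕_ : List ℕ → List ℕ → List ℕ
_⊕_ = cartesianProductWith _+_

map-+-cartesianProduct : {A B : Set} (f : A → ℕ) (g : B → ℕ) (xs : List A) (ys : List B) →
  map (λ (x , y) → f x + g y) (cartesianProduct xs ys) ≡ map f xs ⊕ map g ys
map-+-cartesianProduct f g []       ys = refl
map-+-cartesianProduct f g (x ∷ xs) ys = begin
  map h (map (x ,_) ys ++ cartesianProduct xs ys)          ≡⟨ map-++ h (map (x ,_) ys) _ ⟩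
  map h (map (x ,_) ys) ++ map h (cartesianProduct xs ys) ≡⟨ cong₂ _++_ (trans (sym (map-∘ ys)) (map-∘ ys))
                                                                         (map-+-cartesianProduct f g xs ys) ⟩
  map (f x +_) (map g ys) ++ map f xs ⊕ map g ys           ∎
  where
  open ≡-Reasoning
  h : _ × _ → ℕ
  h (x , y) = f x + g y

⊕-congʳ : (xs : List ℕ) {ys ys′ : List ℕ} → ys ↭ ys′ → xs ⊕ ys ↭ xs ⊕ ys′
⊕-congʳ []       ys↭ys′ = ↭-refl
⊕-congʳ (x ∷ xs) ys↭ys′ = ↭.++⁺ (↭.map⁺ (x +_) ys↭ys′) (⊕-congʳ xs ys↭ys′)

⊕-∷ʳ : (xs : List ℕ) (y : ℕ) (ys : List ℕ) → xs ⊕ (y ∷ ys) ↭ map (_+ y) xs ++ xs ⊕ ys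
⊕-∷ʳ []       y ys = ↭-refl
⊕-∷ʳ (x ∷ xs) y ys = ↭-prep (x + y)
  (↭-trans (↭.++⁺ˡ (map (x +_) ys) (⊕-∷ʳ xs y ys)) (↭.shifts (map (x +_) ys) (map (_+ y) xs)))

⊕-comm : (xs ys : List ℕ) → xs ⊕ ys ↭ ys ⊕ xs
⊕-comm []       ys = ↭-reflexive (sym (cartesianProductWith-zeroʳ _+_ ys))
⊕-comm (x ∷ xs) ys =
  ↭-trans (↭.++⁺ (↭-reflexive (map-cong (+-comm x) ys)) (⊕-comm xs ys)) (↭-sym (⊕-∷ʳ ys x xs))

⊕-cong : {xs xs′ ys ys′ : List ℕ} → xs ↭ xs′ → ys ↭ ys′ → xs ⊕ ys ↭ xs′ ⊕ ys′
⊕-cong {xs} {xs′} {ys} {ys′} xs↭xs′ ys↭ys′ = begin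
  xs ⊕ ys    ↭⟨ ⊕-congʳ xs ys↭ys′ ⟩
  xs ⊕ ys′   ↭⟨ ⊕-comm xs ys′ ⟩
  ys′ ⊕ xs   ↭⟨ ⊕-congʳ ys′ xs↭xs′ ⟩
  ys′ ⊕ xs′  ↭⟨ ⊕-comm ys′ xs′ ⟩
  xs′ ⊕ ys′  ∎
  where open PermutationReasoning

map-+-⊕ : (x : ℕ) (ys zs : List ℕ) → map (x +_) ys ⊕ zs ≡ map (x +_) (ys ⊕ zs)
map-+-⊕ x []       zs = refl
map-+-⊕ x (y ∷ ys) zs =
  trans (cong₂ _++_ (trans (map-cong (+-assoc x y) zs) (map-∘ zs)) (map-+-⊕ x ys zs))
        (sym (map-++ (x +_) (map (y +_) zs) (ys ⊕ zs)))

⊕-assoc : (xs ys zs : List ℕ) → (xs ⊕ ys) ⊕ zs ≡ xs ⊕ (ys ⊕ zs)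
⊕-assoc []       ys zs = refl
⊕-assoc (x ∷ xs) ys zs =
  trans (cartesianProductWith-distribʳ-++ _+_ (map (x +_) ys) (xs ⊕ ys) zs)
        (cong₂ _++_ (map-+-⊕ x ys zs) (⊕-assoc xs ys zs))

⊕-commutativeSemigroup : CommutativeSemigroup _ _
⊕-commutativeSemigroup = record
  { Carrier = List ℕ
  ; _≈_ = _↭_
  ; _∙_ = _⊕_
  ; isCommutativeSemigroup = record
    { isSemigroup = record
      { isMagma = record { isEquivalence = ↭-isEquivalence ; ∙-cong = ⊕-cong }
      ; assoc   = λ xs ys zs → ↭-reflexive (⊕-assoc xs ys zs)
      }
    ; comm = ⊕-comm
    }
  }

⊕-interchange : (ws xs ys zs : List ℕ) → (ws ⊕ xs) ⊕ (ys ⊕ zs) ↭ (ws ⊕ ys) ⊕ (xs ⊕ zs)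
⊕-interchange = CommutativeSemigroupProperties.interchange ⊕-commutativeSemigroup

sum-map-+ : {A : Set} (f g : A → ℕ) (xs : List A) →
  sum (map (λ x → f x + g x) xs) ≡ sum (map f xs) + sum (map g xs)
sum-map-+ f g []       = refl
sum-map-+ f g (x ∷ xs) = trans (cong (f x + g x +_) (sum-map-+ f g xs)) (interchange (f x) (g x) _ _)

sum-map-zero : {A : Set} (xs : List A) → sum (map (λ _ → 0) xs) ≡ 0
sum-map-zero []       = refl
sum-map-zero (_ ∷ xs) = sum-map-zero xs

sumTo-cong : (k : ℕ) {f g : ℕ → ℕ} → (∀ j → f j ≡ g j) → sumTo k f ≡ sumTo k g
sumTo-cong k f≗g = cong sum (map-cong f≗g (upTo (suc k)))

sumTo-suc : (k : ℕ) (f : ℕ → ℕ) → sumTo (suc k) f ≡ f 0 + sumTo k (f ∘ suc)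
sumTo-suc k f =
  cong (λ xs → f 0 + sum xs)
       (trans (map-applyUpTo suc f (suc k)) (sym (map-applyUpTo (λ j → j) (f ∘ suc) (suc k))))

δ : ℕ → ℕ → ℕ
δ x j = if ⌊ x ≟ j ⌋ then 1 else 0

sumTo-δ-zero : (k : ℕ) (f : ℕ → ℕ) → sumTo k (λ j → δ 0 j * f j) ≡ f 0
sumTo-δ-zero zero    f = trans (+-identityʳ _) (+-identityʳ (f 0))
sumTo-δ-zero (suc k) f = begin
  sumTo (suc k) (λ j → δ 0 j * f j)              ≡⟨ sumTo-suc k (λ j → δ 0 j * f j) ⟩
  (f 0 + 0) + sum (map (λ _ → 0) (upTo (suc k))) ≡⟨ cong (f 0 + 0 +_) (sum-map-zero (upTo (suc k))) ⟩
  (f 0 + 0) + 0                                  ≡⟨ trans (+-identityʳ _) (+-identityʳ (f 0)) ⟩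
  f 0                                            ∎
  where open ≡-Reasoning

multiplicity-map-+ : (x k : ℕ) (ys : List ℕ) →
  multiplicity k (map (x +_) ys) ≡ sumTo k (λ j → δ x j * multiplicity (k ∸ j) ys)
multiplicity-map-+ zero    k       ys =
  trans (count-map _ _ ys) (sym (sumTo-δ-zero k (λ j → multiplicity (k ∸ j) ys)))
multiplicity-map-+ (suc x) zero    ys = trans (count-map _ _ ys) (count-false ys)
multiplicity-map-+ (suc x) (suc k) ys = begin
  multiplicity (suc k) (map (suc x +_) ys)
    ≡⟨ count-map _ _ ys ⟩
  count (λ y → ⌊ suc (x + y) ≟ suc k ⌋) ys
    ≡⟨ count-cong-∈ ys (λ {y} _ → ≟-suc (x + y) k) ⟩
  count (λ y → ⌊ x + y ≟ k ⌋) ys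
    ≡⟨ count-map _ _ ys ⟨
  multiplicity k (map (x +_) ys)
    ≡⟨ multiplicity-map-+ x k ys ⟩
  sumTo k (λ j → δ x j * m j)
    ≡⟨ sumTo-cong k (λ j → cong (λ b → (if b then 1 else 0) * m j) (≟-suc x j)) ⟨
  sumTo k (λ j → δ (suc x) (suc j) * m j)
    ≡⟨ sumTo-suc k (λ j → δ (suc x) j * multiplicity (suc k ∸ j) ys) ⟨
  sumTo (suc k) (λ j → δ (suc x) j * multiplicity (suc k ∸ j) ys) ∎
  where
  open ≡-Reasoning
  m : ℕ → ℕ
  m j = multiplicity (k ∸ j) ys

multiplicity-⊕ : (xs ys : List ℕ) (k : ℕ) →
  multiplicity k (xs ⊕ ys) ≡ sumTo k (λ j → multiplicity j xs * multiplicity (k ∸ j) ys)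
multiplicity-⊕ []       ys k = sym (sum-map-zero (upTo (suc k)))
multiplicity-⊕ (x ∷ xs) ys k = begin
  multiplicity k (map (x +_) ys ++ xs ⊕ ys)
    ≡⟨ count-++ _ (map (x +_) ys) (xs ⊕ ys) ⟩
  multiplicity k (map (x +_) ys) + multiplicity k (xs ⊕ ys)
    ≡⟨ cong₂ _+_ (multiplicity-map-+ x k ys) (multiplicity-⊕ xs ys k) ⟩
  sumTo k (λ j → δ x j * m j) + sumTo k (λ j → multiplicity j xs * m j)
    ≡⟨ sum-map-+ (λ j → δ x j * m j) (λ j → multiplicity j xs * m j) (upTo (suc k)) ⟨
  sumTo k (λ j → δ x j * m j + multiplicity j xs * m j)
    ≡⟨ sumTo-cong k (λ j → *-distribʳ-+ (m j) (δ x j) (multiplicity j xs)) ⟨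
  sumTo k (λ j → multiplicity j (x ∷ xs) * m j) ∎
  where
  open ≡-Reasoning
  m : ℕ → ℕ
  m j = multiplicity (k ∸ j) ys

module _ {A : Set} where

  Unique-⊆⇒↭-++ : {xs ys : List A} → Unique xs → xs ⊆ ys → ∃ λ zs → ys ↭ xs ++ zs
  Unique-⊆⇒↭-++ {[]}     {ys} _            _     = ys , ↭-refl
  Unique-⊆⇒↭-++ {x ∷ xs} {ys} (x∉xs ∷ xs!) xs⊆ys
    with as , bs , refl ← ∈-∃++ (xs⊆ys (here refl)) =
    let zs , as++bs↭ = Unique-⊆⇒↭-++ xs! xs⊆as++bs
    in  zs , ↭-trans (↭.shift x as bs) (↭-prep x as++bs↭)
    where
    xs⊆as++bs : xs ⊆ as ++ bs
    xs⊆as++bs z∈xs with ↭.∈-resp-↭ (↭.shift x as bs) (xs⊆ys (there z∈xs))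
    ... | here refl = ⊥-elim (All.lookup x∉xs z∈xs refl)
    ... | there z∈  = z∈

  Unique-⊆-length⇒↭ : {xs ys : List A} → Unique xs → xs ⊆ ys → length xs ≡ length ys → xs ↭ ys
  Unique-⊆-length⇒↭ {xs} {ys} xs! xs⊆ys |xs|≡|ys| with Unique-⊆⇒↭-++ xs! xs⊆ys
  ... | []     , ys↭xs = ↭-sym (↭-trans ys↭xs (↭-reflexive (++-identityʳ xs)))
  ... | z ∷ zs , ys↭xs with () ← +-cancelˡ-≡ (length xs) _ 0
    (trans (sym (length-++ xs)) (trans (sym (↭.↭-length ys↭xs)) (trans (sym |xs|≡|ys|) (sym (+-identityʳ _)))))

  Unique-∷ʳ⁺ : {xs : List A} {x : A} → Unique xs → x ∉ xs → Unique (xs ∷ʳ x)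
  Unique-∷ʳ⁺ xs! x∉xs = Unique.++⁺ xs! ([] ∷ []) λ { (x∈xs , here refl) → x∉xs x∈xs }

  Unique-∷ʳ⁻ : (xs : List A) {x : A} → Unique (xs ∷ʳ x) → Unique xs × x ∉ xs
  Unique-∷ʳ⁻ []       _               = [] , λ ()
  Unique-∷ʳ⁻ (y ∷ xs) (y∉xs∷ʳx ∷ xs!) =
    let xs! , x∉xs = Unique-∷ʳ⁻ xs xs!
    in  All.++⁻ˡ xs y∉xs∷ʳx ∷ xs! ,
        λ { (here refl) → All.head (All.++⁻ʳ xs y∉xs∷ʳx) refl ; (there x∈xs) → x∉xs x∈xs }

map-↭-of-bijection : {A B : Set} {xs : List A} {ys : List B} (f : A → B) →
  (∀ {x x′} → f x ≡ f x′ → x ≡ x′) → Unique xs → Unique ys →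
  (∀ {x} → x ∈ xs → f x ∈ ys) → (∀ {y} → y ∈ ys → ∃ λ x → x ∈ xs × f x ≡ y) →
  map f xs ↭ ys
map-↭-of-bijection {xs = xs} {ys} f f-injective xs! ys! into onto =
  ∼bag⇒↭ (unique∧set⇒bag (Unique.map⁺ f-injective xs!) ys! (mk⇔ to from))
  where
  to : ∀ {y} → y ∈ map f xs → y ∈ ys
  to y∈ with _ , x∈ , refl ← ∈-map⁻ f y∈ = into x∈
  from : ∀ {y} → y ∈ ys → y ∈ map f xs
  from y∈ with _ , x∈ , refl ← onto y∈ = ∈-map⁺ f x∈

map-↭-⊕ : {A B C : Set} (g : A × B → C) (s : C → ℕ) (s₁ : A → ℕ) (s₂ : B → ℕ)
  {xs : List A} {ys : List B} {zs : List C} →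
  map g (cartesianProduct xs ys) ↭ zs →
  (∀ {x y} → x ∈ xs → y ∈ ys → s (g (x , y)) ≡ s₁ x + s₂ y) →
  map s zs ↭ map s₁ xs ⊕ map s₂ ys
map-↭-⊕ g s s₁ s₂ {xs} {ys} g↭zs s-additive = ↭-trans (↭.map⁺ s (↭-sym g↭zs)) (↭-reflexive (begin
  map s (map g (cartesianProduct xs ys))                 ≡⟨ map-∘ _ ⟨
  map (s ∘ g) (cartesianProduct xs ys)                   ≡⟨ map-cong-local (All.tabulate additive) ⟩
  map (λ (x , y) → s₁ x + s₂ y) (cartesianProduct xs ys) ≡⟨ map-+-cartesianProduct s₁ s₂ xs ys ⟩
  map s₁ xs ⊕ map s₂ ys                                  ∎))
  where
  open ≡-Reasoning
  additive : ∀ {p} → p ∈ cartesianProduct xs ys → s (g p) ≡ s₁ (proj₁ p) + s₂ (proj₂ p)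
  additive p∈ = let x∈ , y∈ = ∈-cartesianProduct⁻ xs ys p∈ in s-additive x∈ y∈

concatMap-map≡cartesianProductWith : {A B C : Set} (f : A → B → C) (xs : List A) (ys : List B) →
  concatMap (λ x → map (f x) ys) xs ≡ cartesianProductWith f xs ys
concatMap-map≡cartesianProductWith f []       ys = refl
concatMap-map≡cartesianProductWith f (x ∷ xs) ys =
  cong (map (f x) ys ++_) (concatMap-map≡cartesianProductWith f xs ys)

concatMap-∷-↭ : {A B : Set} (f : A → B) (g : A → List B) (xs : List A) →
  concatMap (λ x → f x ∷ g x) xs ↭ map f xs ++ concatMap g xs
concatMap-∷-↭ f g []       = ↭-refl
concatMap-∷-↭ f g (x ∷ xs) =
  ↭-prep (f x) (↭-trans (↭.++⁺ˡ (g x) (concatMap-∷-↭ f g xs)) (↭.shifts (g x) (map f xs)))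

upTo-suc : (n : ℕ) → upTo (suc n) ≡ 0 ∷ map suc (upTo n)
upTo-suc n = cong (0 ∷_) (sym (map-upTo suc n))

upTo-+ : (m n : ℕ) → upTo (m + n) ≡ upTo m ++ map (m +_) (upTo n)
upTo-+ zero    n = sym (map-id (upTo n))
upTo-+ (suc m) n = begin
  upTo (suc m + n)                                      ≡⟨ upTo-suc (m + n) ⟩
  0 ∷ map suc (upTo (m + n))                            ≡⟨ cong (λ xs → 0 ∷ map suc xs) (upTo-+ m n) ⟩
  0 ∷ map suc (upTo m ++ map (m +_) (upTo n))           ≡⟨ cong (0 ∷_) (map-++ suc (upTo m) _) ⟩
  0 ∷ map suc (upTo m) ++ map suc (map (m +_) (upTo n)) ≡⟨ cong₂ _++_ (sym (upTo-suc m)) (sym (map-∘ (upTo n))) ⟩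
  upTo (suc m) ++ map (suc m +_) (upTo n)               ∎
  where open ≡-Reasoning

upTo-* : (a b : ℕ) → map (a *_) (upTo b) ⊕ upTo a ≡ upTo (a * b)
upTo-* a zero    = cong upTo (sym (*-zeroʳ a))
upTo-* a (suc b) = begin
  map (a *_) (upTo (suc b)) ⊕ upTo a
    ≡⟨ cong (λ xs → map (a *_) xs ⊕ upTo a) (upTo-suc b) ⟩
  map (a * 0 +_) (upTo a) ++ map (a *_) (map suc (upTo b)) ⊕ upTo a
    ≡⟨ cong₂ _++_ (trans (map-cong (λ x → cong (_+ x) (*-zeroʳ a)) (upTo a)) (map-id (upTo a)))
                  (cong (_⊕ upTo a) a*suc) ⟩
  upTo a ++ map (a +_) (map (a *_) (upTo b)) ⊕ upTo a
    ≡⟨ cong (upTo a ++_) (trans (map-+-⊕ a (map (a *_) (upTo b)) (upTo a)) (cong (map (a +_)) (upTo-* a b))) ⟩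
  upTo a ++ map (a +_) (upTo (a * b))
    ≡⟨ upTo-+ a (a * b) ⟨
  upTo (a + a * b)
    ≡⟨ cong upTo (*-suc a b) ⟨
  upTo (a * suc b) ∎
  where
  open ≡-Reasoning
  a*suc : map (a *_) (map suc (upTo b)) ≡ map (a +_) (map (a *_) (upTo b))
  a*suc = trans (sym (map-∘ (upTo b))) (trans (map-cong (*-suc a) (upTo b)) (map-∘ (upTo b)))

map-∸-upTo-↭ : (n : ℕ) → map (n ∸_) (upTo (suc n)) ↭ upTo (suc n)
map-∸-upTo-↭ zero    = ↭-refl
map-∸-upTo-↭ (suc n) = begin
  suc n ∷ map (suc n ∸_) (applyUpTo suc (suc n))  ≡⟨ cong ((suc n ∷_) ∘ map (suc n ∸_)) (map-upTo suc (suc n)) ⟨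
  suc n ∷ map (suc n ∸_) (map suc (upTo (suc n))) ≡⟨ cong (suc n ∷_) (map-∘ (upTo (suc n))) ⟨
  suc n ∷ map (n ∸_) (upTo (suc n))               ↭⟨ ↭-prep (suc n) (map-∸-upTo-↭ n) ⟩
  suc n ∷ upTo (suc n)                            ↭⟨ ↭.∷↭∷ʳ (suc n) (upTo (suc n)) ⟩
  upTo (suc n) ∷ʳ suc n                           ≡⟨ upTo-∷ʳ (suc n) ⟩
  upTo (suc (suc n))                              ∎
  where open PermutationReasoning

count-<-upTo : (u n : ℕ) → u ≤ n → count (λ z → ⌊ z <? u ⌋) (upTo n) ≡ u
count-<-upTo zero    n       _         = count-false (upTo n)
count-<-upTo (suc u) (suc n) (s≤s u≤n) = cong suc (begin
  count (λ z → ⌊ z <? suc u ⌋) (applyUpTo suc n)  ≡⟨ cong (count _) (map-upTo suc n) ⟨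
  count (λ z → ⌊ z <? suc u ⌋) (map suc (upTo n)) ≡⟨ count-map _ suc (upTo n) ⟩
  count (λ z → ⌊ suc z <? suc u ⌋) (upTo n)       ≡⟨ count-cong-∈ (upTo n) (λ {z} _ → <?-suc z u) ⟩
  count (λ z → ⌊ z <? u ⌋) (upTo n)               ≡⟨ count-<-upTo u n u≤n ⟩
  u                                               ∎)
  where open ≡-Reasoning

count-≤-upTo : (u n : ℕ) → count (λ z → ⌊ u ≤? z ⌋) (upTo n) ≡ n ∸ u
count-≤-upTo zero    n       = trans (count-true (upTo n)) (length-upTo n)
count-≤-upTo (suc u) zero    = refl
count-≤-upTo (suc u) (suc n) = begin
  count (λ z → ⌊ suc u ≤? z ⌋) (applyUpTo suc n)  ≡⟨ cong (count _) (map-upTo suc n) ⟨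
  count (λ z → ⌊ suc u ≤? z ⌋) (map suc (upTo n)) ≡⟨ count-map _ suc (upTo n) ⟩
  count (λ z → ⌊ suc u ≤? suc z ⌋) (upTo n)       ≡⟨ count-cong-∈ (upTo n) (λ {z} _ → ≤?-suc u z) ⟩
  count (λ z → ⌊ u ≤? z ⌋) (upTo n)               ≡⟨ count-≤-upTo u n ⟩
  n ∸ u                                           ∎
  where open ≡-Reasoning

∈-[]⁻ : {n x : ℕ} → x ∈ [ n ] → 0 < x × x ≤ n
∈-[]⁻ x∈ with y , y∈ , refl ← ∈-map⁻ suc x∈ = z<s , ∈-upTo⁻ y∈

∈-[]⁺ : {n x : ℕ} → 0 < x → x ≤ n → x ∈ [ n ]
∈-[]⁺ {x = suc x} _ x<n = ∈-map⁺ suc (∈-upTo⁺ x<n)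

[]-unique : (n : ℕ) → Unique [ n ]
[]-unique n = Unique.map⁺ suc-injective (Unique.upTo⁺ n)

length-[] : (n : ℕ) → length [ n ] ≡ n
length-[] n = trans (length-map suc (upTo n)) (length-upTo n)

[]-suc : (n : ℕ) → [ suc n ] ≡ [ n ] ∷ʳ suc n
[]-suc n = trans (cong (map suc) (sym (upTo-∷ʳ n))) (map-++ suc (upTo n) (n ∷ []))

count-<-[] : (u n : ℕ) → u ≤ n → count (λ x → ⌊ x <? suc u ⌋) [ n ] ≡ u
count-<-[] u n u≤n =
  trans (count-map _ suc (upTo n)) (trans (count-cong-∈ (upTo n) (λ {z} _ → <?-suc z u)) (count-<-upTo u n u≤n))

count-≤-[] : (u n : ℕ) → count (λ x → ⌊ suc u ≤? x ⌋) [ n ] ≡ n ∸ u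
count-≤-[] u n =
  trans (count-map _ suc (upTo n)) (trans (count-cong-∈ (upTo n) (λ {z} _ → ≤?-suc u z)) (count-≤-upTo u n))

module _ {A : Set} where

  words-suc : (n : ℕ) (as : List A) → words (suc n) as ≡ cartesianProductWith _∷_ as (words n as)
  words-suc n as = concatMap-map≡cartesianProductWith _∷_ as (words n as)

  ∈-words⁻ : (n : ℕ) (as : List A) {w : List A} → w ∈ words n as → length w ≡ n × All (_∈ as) w
  ∈-words⁻ zero    as (here refl) = refl , []
  ∈-words⁻ (suc n) as w∈
    with _ , _ , a∈ , w′∈ , refl ←
         ∈-cartesianProductWith⁻ _∷_ as (words n as) (subst (_ ∈_) (words-suc n as) w∈) =
    let |w′|≡n , w′⊆as = ∈-words⁻ n as w′∈ in cong suc |w′|≡n , a∈ ∷ w′⊆as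

  ∈-words⁺ : (n : ℕ) (as : List A) {w : List A} → length w ≡ n → All (_∈ as) w → w ∈ words n as
  ∈-words⁺ zero    as {[]}    refl  []            = here refl
  ∈-words⁺ (suc n) as {a ∷ w} |w|≡n (a∈ ∷ w⊆as) = subst (_ ∈_) (sym (words-suc n as))
    (∈-cartesianProductWith⁺ _∷_ a∈ (∈-words⁺ n as (suc-injective |w|≡n) w⊆as))

  words-unique : (n : ℕ) {as : List A} → Unique as → Unique (words n as)
  words-unique zero         as! = [] ∷ []
  words-unique (suc n) {as} as! =
    subst Unique (sym (words-suc n as)) (Unique.cartesianProductWith⁺ _∷_ ∷-injective as! (words-unique n as!))

  map-∷ʳ-words-↭ : (n : ℕ) {as : List A} → Unique as →
    map (uncurry _∷ʳ_) (cartesianProduct (words n as) as) ↭ words (suc n) as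
  map-∷ʳ-words-↭ n {as} as! = map-↭-of-bijection (uncurry _∷ʳ_) ∷ʳ-injective′
    (Unique.cartesianProduct⁺ (words-unique n as!) as!) (words-unique (suc n) as!) into onto
    where
    ∷ʳ-injective′ : ∀ {p q} → uncurry _∷ʳ_ p ≡ uncurry _∷ʳ_ q → p ≡ q
    ∷ʳ-injective′ {w , _} {w′ , _} eq with refl , refl ← ∷ʳ-injective w w′ eq = refl
    into : ∀ {p} → p ∈ cartesianProduct (words n as) as → uncurry _∷ʳ_ p ∈ words (suc n) as
    into {w , a} p∈ =
      let w∈ , a∈      = ∈-cartesianProduct⁻ (words n as) as p∈
          |w|≡n , w⊆as = ∈-words⁻ n as w∈
      in  ∈-words⁺ (suc n) as (trans (length-++ w) (trans (+-comm _ 1) (cong suc |w|≡n)))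
                              (All.++⁺ w⊆as (a∈ ∷ []))
    onto : ∀ {w} → w ∈ words (suc n) as →
           ∃ λ p → p ∈ cartesianProduct (words n as) as × uncurry _∷ʳ_ p ≡ w
    onto {w} w∈ with initLast w | ∈-words⁻ (suc n) as w∈
    ... | []       | () , _
    ... | w′ ∷ʳ′ a | |w|≡1+n , w⊆as =
      (w′ , a) ,
      ∈-cartesianProduct⁺ (∈-words⁺ n as |w′|≡n (All.++⁻ˡ w′ w⊆as)) (All.head (All.++⁻ʳ w′ w⊆as)) ,
      refl
      where
      |w′|≡n : length w′ ≡ n
      |w′|≡n = suc-injective (trans (+-comm 1 _) (trans (sym (length-++ w′)) |w|≡1+n))

words-map : {A B : Set} (f : A → B) (n : ℕ) (as : List A) → words n (map f as) ≡ map (map f) (words n as)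
words-map f zero    as = refl
words-map f (suc n) as = begin
  concatMap (λ b → map (b ∷_) (words n (map f as))) (map f as)
    ≡⟨ concatMap-map _ f as ⟩
  concatMap (λ a → map (f a ∷_) (words n (map f as))) as
    ≡⟨ concatMap-cong (λ a → cong (map (f a ∷_)) (words-map f n as)) as ⟩
  concatMap (λ a → map (f a ∷_) (map (map f) (words n as))) as
    ≡⟨ concatMap-cong (λ a → trans (sym (map-∘ _)) (map-∘ _)) as ⟩
  concatMap (λ a → map (map f) (map (a ∷_) (words n as))) as
    ≡⟨ map-concatMap (map f) _ as ⟨
  map (map f) (words (suc n) as) ∎
  where open ≡-Reasoning

zip-∷ʳ : {A B : Set} (xs : List A) (ys : List B) {x : A} {y : B} → length xs ≡ length ys →
  zip (xs ∷ʳ x) (ys ∷ʳ y) ≡ zip xs ys ∷ʳ (x , y)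
zip-∷ʳ []       []       _         = refl
zip-∷ʳ (x ∷ xs) (y ∷ ys) |xs|≡|ys| = cong ((x , y) ∷_) (zip-∷ʳ xs ys (suc-injective |xs|≡|ys|))

weight-∷ʳ : (w : List ℕ) (a : ℕ) → weight (w ∷ʳ a) ≡ weight w + suc (length w) * a
weight-∷ʳ w a = begin
  sum (map term (zip [ length (w ∷ʳ a) ] (w ∷ʳ a)))
    ≡⟨ cong (λ k → sum (map term (zip [ k ] (w ∷ʳ a)))) (trans (length-++ w) (+-comm _ 1)) ⟩
  sum (map term (zip [ suc (length w) ] (w ∷ʳ a)))
    ≡⟨ cong (λ is → sum (map term (zip is (w ∷ʳ a)))) ([]-suc (length w)) ⟩
  sum (map term (zip ([ length w ] ∷ʳ suc (length w)) (w ∷ʳ a)))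
    ≡⟨ cong (sum ∘ map term) (zip-∷ʳ [ length w ] w (length-[] (length w))) ⟩
  sum (map term (zip [ length w ] w ∷ʳ (suc (length w) , a)))
    ≡⟨ cong sum (map-++ term (zip [ length w ] w) _) ⟩
  sum (map term (zip [ length w ] w) ∷ʳ suc (length w) * a)
    ≡⟨ sum-++ (map term (zip [ length w ] w)) _ ⟩
  weight w + (suc (length w) * a + 0)
    ≡⟨ cong (weight w +_) (+-identityʳ _) ⟩
  weight w + suc (length w) * a ∎
  where
  open ≡-Reasoning
  term : ℕ × ℕ → ℕ
  term (t , m) = t * m

weight-words-suc : (n : ℕ) {as : List ℕ} → Unique as →
  map weight (words (suc n) as) ↭ map weight (words n as) ⊕ map (suc n *_) as
weight-words-suc n {as} as! =
  map-↭-⊕ (uncurry _∷ʳ_) weight weight (suc n *_) (map-∷ʳ-words-↭ n as!) additive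
  where
  additive : ∀ {w a} → w ∈ words n as → a ∈ as → weight (w ∷ʳ a) ≡ weight w + suc n * a
  additive {w} {a} w∈ _ =
    trans (weight-∷ʳ w a) (cong (λ k → weight w + suc k * a) (proj₁ (∈-words⁻ n as w∈)))

pairs : {A : Set} → (A → A → Bool) → List A → ℕ
pairs R []       = 0
pairs R (x ∷ xs) = count (R x) xs + pairs R xs

pairs-∷ʳ : {A : Set} (R : A → A → Bool) (xs : List A) (y : A) →
  pairs R (xs ∷ʳ y) ≡ pairs R xs + count (λ x → R x y) xs
pairs-∷ʳ R []       y = refl
pairs-∷ʳ R (x ∷ xs) y = begin
  count (R x) (xs ∷ʳ y) + pairs R (xs ∷ʳ y)
    ≡⟨ cong₂ _+_ (count-++ (R x) xs (y ∷ [])) (pairs-∷ʳ R xs y) ⟩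
  (count (R x) xs + ((if R x y then 1 else 0) + 0)) + (pairs R xs + count (λ z → R z y) xs)
    ≡⟨ cong (λ k → count (R x) xs + k + _) (+-identityʳ _) ⟩
  (count (R x) xs + (if R x y then 1 else 0)) + (pairs R xs + count (λ z → R z y) xs)
    ≡⟨ interchange (count (R x) xs) _ (pairs R xs) _ ⟩
  (count (R x) xs + pairs R xs) + count (λ z → R z y) (x ∷ xs) ∎
  where open ≡-Reasoning

pairs-map : {A B : Set} (R : B → B → Bool) (S : A → A → Bool) (f : A → B) →
  (∀ x y → R (f x) (f y) ≡ S x y) → (xs : List A) → pairs R (map f xs) ≡ pairs S xs
pairs-map R S f R∘f≗S []       = refl
pairs-map R S f R∘f≗S (x ∷ xs) = cong₂ _+_
  (trans (count-map (R (f x)) f xs) (count-cong-∈ xs (λ {y} _ → R∘f≗S x y)))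
  (pairs-map R S f R∘f≗S xs)

invRel : ℕ → ℕ → Bool
invRel x y = ⌊ y <? x ⌋

inv≡pairs : (π : List ℕ) → inv π ≡ pairs invRel π
inv≡pairs []      = refl
inv≡pairs (x ∷ π) = cong (count (invRel x) π +_) (inv≡pairs π)

colRel : ℕ × ℕ → ℕ × ℕ → Bool
colRel (x , _) (y , d) = ⌊ x <? y ⌋ ∧ ⌊ ¬? (d ≟ 0) ⌋

colPairs≡pairs : (σ : List (ℕ × ℕ)) → colPairs σ ≡ pairs colRel σ
colPairs≡pairs []      = refl
colPairs≡pairs (p ∷ σ) = cong (count (colRel p) σ +_) (colPairs≡pairs σ)

-- ℕ-versions of Data.Fin's punchIn/punchOut: punchIn v skips the value v, punchOut v undoes it
-- (punchOut v v is junk).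
punchIn : ℕ → ℕ → ℕ
punchIn zero    x       = suc x
punchIn (suc v) zero    = zero
punchIn (suc v) (suc x) = suc (punchIn v x)

punchOut : ℕ → ℕ → ℕ
punchOut zero    u       = pred u
punchOut (suc v) zero    = zero
punchOut (suc v) (suc u) = suc (punchOut v u)

punchOut-punchIn : (v x : ℕ) → punchOut v (punchIn v x) ≡ x
punchOut-punchIn zero    x       = refl
punchOut-punchIn (suc v) zero    = refl
punchOut-punchIn (suc v) (suc x) = cong suc (punchOut-punchIn v x)

punchIn-punchOut : (v u : ℕ) → u ≢ v → punchIn v (punchOut v u) ≡ u
punchIn-punchOut zero    zero    u≢v = ⊥-elim (u≢v refl)
punchIn-punchOut zero    (suc u) u≢v = refl
punchIn-punchOut (suc v) zero    u≢v = refl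
punchIn-punchOut (suc v) (suc u) u≢v = cong suc (punchIn-punchOut v u (u≢v ∘ cong suc))

punchIn-injective : (v : ℕ) {x y : ℕ} → punchIn v x ≡ punchIn v y → x ≡ y
punchIn-injective v {x} {y} eq =
  trans (sym (punchOut-punchIn v x)) (trans (cong (punchOut v) eq) (punchOut-punchIn v y))

punchInᵥ≢v : (v x : ℕ) → punchIn v x ≢ v
punchInᵥ≢v zero    x       ()
punchInᵥ≢v (suc v) zero    ()
punchInᵥ≢v (suc v) (suc x) eq = punchInᵥ≢v v x (suc-injective eq)

punchIn-mono-< : (v : ℕ) {x y : ℕ} → x < y → punchIn v x < punchIn v y
punchIn-mono-< zero    x<y                          = s<s x<y
punchIn-mono-< (suc v) {zero}  {suc y} _            = z<s
punchIn-mono-< (suc v) {suc x} {suc y} (s<s x<y)    = s<s (punchIn-mono-< v x<y)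

punchIn-cancel-< : (v : ℕ) {x y : ℕ} → punchIn v x < punchIn v y → x < y
punchIn-cancel-< zero    (s<s x<y)                  = x<y
punchIn-cancel-< (suc v) {zero}  {suc y} _          = z<s
punchIn-cancel-< (suc v) {suc x} {suc y} (s<s p<p)  = s<s (punchIn-cancel-< v p<p)

punchIn<v⇒<v : (v : ℕ) {x : ℕ} → punchIn v x < v → x < v
punchIn<v⇒<v (suc v) {zero}  _         = z<s
punchIn<v⇒<v (suc v) {suc x} (s<s p<v) = s<s (punchIn<v⇒<v v p<v)

<v⇒punchIn<v : (v : ℕ) {x : ℕ} → x < v → punchIn v x < v
<v⇒punchIn<v (suc v) {zero}  _         = z<s
<v⇒punchIn<v (suc v) {suc x} (s<s x<v) = s<s (<v⇒punchIn<v v x<v)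

v<punchIn⇒v≤ : (v : ℕ) {x : ℕ} → v < punchIn v x → v ≤ x
v<punchIn⇒v≤ zero            _         = z≤n
v<punchIn⇒v≤ (suc v) {suc x} (s<s v<p) = s≤s (v<punchIn⇒v≤ v v<p)

v≤⇒v<punchIn : (v : ℕ) {x : ℕ} → v ≤ x → v < punchIn v x
v≤⇒v<punchIn zero            _         = z<s
v≤⇒v<punchIn (suc v) {suc x} (s≤s v≤x) = s<s (v≤⇒v<punchIn v v≤x)

x≤punchIn : (v x : ℕ) → x ≤ punchIn v x
x≤punchIn zero    x       = n≤1+n x
x≤punchIn (suc v) zero    = z≤n
x≤punchIn (suc v) (suc x) = s≤s (x≤punchIn v x)

punchIn≤suc : (v x : ℕ) → punchIn v x ≤ suc x
punchIn≤suc zero    x       = ≤-refl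
punchIn≤suc (suc v) zero    = z≤n
punchIn≤suc (suc v) (suc x) = s≤s (punchIn≤suc v x)

punchIn-cancel-≤ : (v : ℕ) {x n : ℕ} → v ≤ suc n → punchIn v x ≤ suc n → x ≤ n
punchIn-cancel-≤ zero                   _           (s≤s x≤n)   = x≤n
punchIn-cancel-≤ (suc v)       {zero}   _           _           = z≤n
punchIn-cancel-≤ (suc v)       {suc x} {suc n} (s≤s v≤1+n) (s≤s p≤1+n) = s≤s (punchIn-cancel-≤ v v≤1+n p≤1+n)
punchIn-cancel-≤ (suc zero)    {suc x} {zero}  _           (s≤s ())
punchIn-cancel-≤ (suc (suc v)) {suc x} {zero}  (s≤s ())    _

punchIn-cancel-pos : (v : ℕ) {x : ℕ} → 0 < v → 0 < punchIn v x → 0 < x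
punchIn-cancel-pos (suc v) {suc x} _ _ = z<s

punchIn-<? : (v x y : ℕ) → ⌊ punchIn v x <? punchIn v y ⌋ ≡ ⌊ x <? y ⌋
punchIn-<? v x y = ⌊⌋-⇔ (mk⇔ (punchIn-cancel-< v) (punchIn-mono-< v)) (punchIn v x <? punchIn v y) (x <? y)

punchIn<v? : (v x : ℕ) → ⌊ punchIn v x <? v ⌋ ≡ ⌊ x <? v ⌋
punchIn<v? v x = ⌊⌋-⇔ (mk⇔ (punchIn<v⇒<v v) (<v⇒punchIn<v v)) (punchIn v x <? v) (x <? v)

v<punchIn? : (v x : ℕ) → ⌊ v <? punchIn v x ⌋ ≡ ⌊ v ≤? x ⌋
v<punchIn? v x = ⌊⌋-⇔ (mk⇔ (v<punchIn⇒v≤ v) (v≤⇒v<punchIn v)) (v <? punchIn v x) (v ≤? x)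

letters : ℕ → ℕ → List (ℕ × ℕ)
letters c n = concatMap (λ a → map (a ,_) (colors c)) [ n ]

IsLetter : ℕ → ℕ → ℕ × ℕ → Set
IsLetter c n (x , d) = (0 < x × x ≤ n) × d < c

letters≡cartesianProduct : (c n : ℕ) → letters c n ≡ cartesianProduct [ n ] (upTo c)
letters≡cartesianProduct c n = concatMap-map≡cartesianProductWith _,_ [ n ] (upTo c)

∈-letters⁻ : (c n : ℕ) {p : ℕ × ℕ} → p ∈ letters c n → IsLetter c n p
∈-letters⁻ c n p∈ =
  let x∈ , d∈ = ∈-cartesianProduct⁻ [ n ] (upTo c) (subst (_ ∈_) (letters≡cartesianProduct c n) p∈)
  in  ∈-[]⁻ x∈ , ∈-upTo⁻ d∈

∈-letters⁺ : (c n : ℕ) {p : ℕ × ℕ} → IsLetter c n p → p ∈ letters c n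
∈-letters⁺ c n ((0<x , x≤n) , d<c) =
  subst (_ ∈_) (sym (letters≡cartesianProduct c n)) (∈-cartesianProduct⁺ (∈-[]⁺ 0<x x≤n) (∈-upTo⁺ d<c))

letters-unique : (c n : ℕ) → Unique (letters c n)
letters-unique c n =
  subst Unique (sym (letters≡cartesianProduct c n)) (Unique.cartesianProduct⁺ ([]-unique n) (Unique.upTo⁺ c))

distinctEntries? : (σ : List (ℕ × ℕ)) → Dec (Unique (map proj₁ σ))
distinctEntries? σ = UniqueDec.unique? _≟_ (map proj₁ σ)

IsColoredPerm : ℕ → ℕ → List (ℕ × ℕ) → Set
IsColoredPerm c n σ = length σ ≡ n × All (IsLetter c n) σ × Unique (map proj₁ σ)

∈-coloredPerms⁻ : (c n : ℕ) {σ : List (ℕ × ℕ)} → σ ∈ coloredPerms c n → IsColoredPerm c n σ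
∈-coloredPerms⁻ c n σ∈ =
  let σ∈words , σ!         = ∈-filter⁻ distinctEntries? σ∈
      |σ|≡n , σ⊆letters = ∈-words⁻ n (letters c n) σ∈words
  in  |σ|≡n , All.map (∈-letters⁻ c n) σ⊆letters , σ!

∈-coloredPerms⁺ : (c n : ℕ) {σ : List (ℕ × ℕ)} → IsColoredPerm c n σ → σ ∈ coloredPerms c n
∈-coloredPerms⁺ c n (|σ|≡n , σ-letters , σ!) =
  ∈-filter⁺ distinctEntries? (∈-words⁺ n (letters c n) |σ|≡n (All.map (∈-letters⁺ c n) σ-letters)) σ!

coloredPerms-unique : (c n : ℕ) → Unique (coloredPerms c n)
coloredPerms-unique c n = Unique.filter⁺ distinctEntries? (words-unique n (letters-unique c n))

IsColoredPerm⇒↭[] : {c n : ℕ} {σ : List (ℕ × ℕ)} → IsColoredPerm c n σ → map proj₁ σ ↭ [ n ]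
IsColoredPerm⇒↭[] {c} {n} {σ} (|σ|≡n , σ-letters , σ!) =
  Unique-⊆-length⇒↭ σ! entries⊆[n] (trans (length-map proj₁ σ) (trans |σ|≡n (sym (length-[] n))))
  where
  entries⊆[n] : map proj₁ σ ⊆ [ n ]
  entries⊆[n] x∈ with p , p∈ , refl ← ∈-map⁻ proj₁ x∈ =
    let (0<x , x≤n) , _ = All.lookup σ-letters p∈ in ∈-[]⁺ 0<x x≤n

-- Inverse of standardisation: σ is relabelled onto [n+1] ∖ {v} and the letter (v , d) is appended.
extend : List (ℕ × ℕ) × (ℕ × ℕ) → List (ℕ × ℕ)
extend (σ , (v , d)) = map (map₁ (punchIn v)) σ ∷ʳ (v , d)

map-proj₁-map₁ : (f : ℕ → ℕ) (σ : List (ℕ × ℕ)) → map proj₁ (map (map₁ f) σ) ≡ map f (map proj₁ σ)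
map-proj₁-map₁ f σ = trans (sym (map-∘ σ)) (map-∘ σ)

map-proj₁-extend : (σ : List (ℕ × ℕ)) (v d : ℕ) →
  map proj₁ (extend (σ , (v , d))) ≡ map (punchIn v) (map proj₁ σ) ∷ʳ v
map-proj₁-extend σ v d =
  trans (map-++ proj₁ (map (map₁ (punchIn v)) σ) _) (cong (_∷ʳ v) (map-proj₁-map₁ (punchIn v) σ))

extend-injective : ∀ {p q} → extend p ≡ extend q → p ≡ q
extend-injective {σ , (v , d)} {σ′ , _} eq with σ≡σ′ , refl ← ∷ʳ-injective _ _ eq =
  cong (_, (v , d))
       (map-injective (λ eq′ → cong₂ _,_ (punchIn-injective v (cong proj₁ eq′)) (cong proj₂ eq′)) σ≡σ′)

punchIn-IsLetter : {c n : ℕ} (v : ℕ) {p : ℕ × ℕ} →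
  IsLetter c n p → IsLetter c (suc n) (map₁ (punchIn v) p)
punchIn-IsLetter v {x , _} ((0<x , x≤n) , d<c) =
  (≤-trans 0<x (x≤punchIn v x) , ≤-trans (punchIn≤suc v x) (s≤s x≤n)) , d<c

punchOut-IsLetter : {c n v : ℕ} → 0 < v → v ≤ suc n → {p : ℕ × ℕ} → proj₁ p ≢ v →
  IsLetter c (suc n) p → IsLetter c n (map₁ (punchOut v) p)
punchOut-IsLetter {v = v} 0<v v≤1+n {x , _} x≢v ((0<x , x≤1+n) , d<c) =
  (punchIn-cancel-pos v 0<v (subst (0 <_) (sym x≡) 0<x) ,
   punchIn-cancel-≤ v v≤1+n (subst (_≤ _) (sym x≡) x≤1+n)) ,
  d<c
  where
  x≡ : punchIn v (punchOut v x) ≡ x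
  x≡ = punchIn-punchOut v x x≢v

extend-IsColoredPerm : {c n : ℕ} {σ : List (ℕ × ℕ)} {v d : ℕ} →
  IsColoredPerm c n σ → IsLetter c (suc n) (v , d) → IsColoredPerm c (suc n) (extend (σ , (v , d)))
extend-IsColoredPerm {c} {n} {σ} {v} {d} (|σ|≡n , σ-letters , σ!) vd-letter =
  |extend|≡1+n ,
  All.++⁺ (All.map⁺ (All.map (punchIn-IsLetter v) σ-letters)) (vd-letter ∷ []) ,
  subst Unique (sym (map-proj₁-extend σ v d)) (Unique-∷ʳ⁺ (Unique.map⁺ (punchIn-injective v) σ!) v∉)
  where
  |extend|≡1+n : length (extend (σ , (v , d))) ≡ suc n
  |extend|≡1+n =
    trans (length-++ (map (map₁ (punchIn v)) σ)) (trans (+-comm _ 1) (cong suc (trans (length-map _ σ) |σ|≡n)))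
  v∉ : v ∉ map (punchIn v) (map proj₁ σ)
  v∉ v∈ with x , _ , v≡ ← ∈-map⁻ (punchIn v) v∈ = punchInᵥ≢v v x (sym v≡)

extend-surjective : {c n : ℕ} {τ : List (ℕ × ℕ)} → IsColoredPerm c (suc n) τ →
  ∃ λ p → (IsColoredPerm c n (proj₁ p) × IsLetter c (suc n) (proj₂ p)) × extend p ≡ τ
extend-surjective {c} {n} {τ} τ-perm with initLast τ | τ-perm
... | []             | () , _
... | τ′ ∷ʳ′ (v , d) | |τ|≡1+n , τ-letters , τ! =
  (σ , (v , d)) , ((|σ|≡n , σ-letters , σ!) , vd-letter) , cong (_∷ʳ (v , d)) punchIn∘punchOut
  where
  vd-letter : IsLetter c (suc n) (v , d)
  vd-letter = All.head (All.++⁻ʳ τ′ τ-letters)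
  τ′!×v∉ : Unique (map proj₁ τ′) × v ∉ map proj₁ τ′
  τ′!×v∉ = Unique-∷ʳ⁻ (map proj₁ τ′) (subst Unique (map-++ proj₁ τ′ _) τ!)
  τ′≢v : ∀ {p} → p ∈ τ′ → proj₁ p ≢ v
  τ′≢v p∈ refl = proj₂ τ′!×v∉ (∈-map⁺ proj₁ p∈)
  σ : List (ℕ × ℕ)
  σ = map (map₁ (punchOut v)) τ′
  punchIn∘punchOut : map (map₁ (punchIn v)) σ ≡ τ′
  punchIn∘punchOut = trans (sym (map-∘ τ′))
    (map-id-local (All.tabulate λ {p} p∈ → cong (_, proj₂ p) (punchIn-punchOut v (proj₁ p) (τ′≢v p∈))))
  |σ|≡n : length σ ≡ n
  |σ|≡n = trans (length-map _ τ′) (suc-injective (trans (+-comm 1 _) (trans (sym (length-++ τ′)) |τ|≡1+n)))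
  σ-letters : All (IsLetter c n) σ
  σ-letters = All.map⁺ (All.tabulate λ p∈ →
    let (0<v , v≤1+n) , _ = vd-letter
    in  punchOut-IsLetter 0<v v≤1+n (τ′≢v p∈) (All.lookup (All.++⁻ˡ τ′ τ-letters) p∈))
  σ! : Unique (map proj₁ σ)
  σ! = Unique.map⁻ (subst Unique
    (trans (cong (map proj₁) (sym punchIn∘punchOut)) (map-proj₁-map₁ (punchIn v) σ)) (proj₁ τ′!×v∉))

extend-↭ : (c n : ℕ) → map extend (cartesianProduct (coloredPerms c n) (letters c (suc n))) ↭ coloredPerms c (suc n)
extend-↭ c n = map-↭-of-bijection extend extend-injective
  (Unique.cartesianProduct⁺ (coloredPerms-unique c n) (letters-unique c (suc n))) (coloredPerms-unique c (suc n))
  into onto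
  where
  G×L = cartesianProduct (coloredPerms c n) (letters c (suc n))
  into : ∀ {p} → p ∈ G×L → extend p ∈ coloredPerms c (suc n)
  into {σ , (v , d)} p∈ =
    let σ∈ , vd∈ = ∈-cartesianProduct⁻ (coloredPerms c n) (letters c (suc n)) p∈
    in  ∈-coloredPerms⁺ c (suc n) (extend-IsColoredPerm (∈-coloredPerms⁻ c n σ∈) (∈-letters⁻ c (suc n) vd∈))
  onto : ∀ {τ} → τ ∈ coloredPerms c (suc n) → ∃ λ p → p ∈ G×L × extend p ≡ τ
  onto τ∈ with (σ , vd) , (σ-perm , vd-letter) , extend≡τ ← extend-surjective (∈-coloredPerms⁻ c (suc n) τ∈) =
    (σ , vd) , ∈-cartesianProduct⁺ (∈-coloredPerms⁺ c n σ-perm) (∈-letters⁺ c (suc n) vd-letter) , extend≡τ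

-- The increase of inv_c when (v , d) is appended: the n + 1 - v earlier entries above v are
-- inversions, d is added to col, and if d ≠ 0 each of the v - 1 earlier entries below v gives c.
lastColPairs : ℕ × ℕ → ℕ
lastColPairs (v , zero)  = 0
lastColPairs (v , suc _) = v ∸ 1

lastStat : ℕ → ℕ → ℕ × ℕ → ℕ
lastStat c n (v , d) = n ∸ (v ∸ 1) + d + c * lastColPairs (v , d)

module _ {c n : ℕ} {σ : List (ℕ × ℕ)} (σ-perm : IsColoredPerm c n σ) (u d : ℕ) where

  private
    π = map proj₁ σ
    v = suc u
    σ′ = map (map₁ (punchIn v)) σ

  inv-extend : inv (map proj₁ (extend (σ , (v , d)))) ≡ inv π + (n ∸ u)
  inv-extend = begin
    inv (map proj₁ (extend (σ , (v , d))))
      ≡⟨ trans (cong inv (map-proj₁-extend σ v d)) (inv≡pairs (map (punchIn v) π ∷ʳ v)) ⟩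
    pairs invRel (map (punchIn v) π ∷ʳ v)
      ≡⟨ pairs-∷ʳ invRel (map (punchIn v) π) v ⟩
    pairs invRel (map (punchIn v) π) + count (λ x → ⌊ v <? x ⌋) (map (punchIn v) π)
      ≡⟨ cong₂ _+_ (pairs-map invRel invRel (punchIn v) (λ x y → punchIn-<? v y x) π)
                   (trans (count-map _ (punchIn v) π) (count-cong-∈ π (λ {x} _ → v<punchIn? v x))) ⟩
    pairs invRel π + count (λ x → ⌊ v ≤? x ⌋) π
      ≡⟨ cong₂ _+_ (sym (inv≡pairs π)) (trans (count-↭ _ (IsColoredPerm⇒↭[] σ-perm)) (count-≤-[] u n)) ⟩
    inv π + (n ∸ u) ∎
    where open ≡-Reasoning

  col-extend : col (extend (σ , (v , d))) ≡ col σ + d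
  col-extend = begin
    sum (map proj₂ (σ′ ∷ʳ (v , d)))    ≡⟨ cong sum (map-++ proj₂ σ′ _) ⟩
    sum (map proj₂ σ′ ∷ʳ d)            ≡⟨ sum-++ (map proj₂ σ′) _ ⟩
    sum (map proj₂ σ′) + (d + 0)       ≡⟨ cong₂ _+_ (cong sum (sym (map-∘ σ))) (+-identityʳ d) ⟩
    col σ + d                          ∎
    where open ≡-Reasoning

  colPairs-extend : u ≤ n → colPairs (extend (σ , (v , d))) ≡ colPairs σ + lastColPairs (v , d)
  colPairs-extend u≤n = begin
    colPairs (σ′ ∷ʳ (v , d))
      ≡⟨ trans (colPairs≡pairs (σ′ ∷ʳ (v , d))) (pairs-∷ʳ colRel σ′ (v , d)) ⟩
    pairs colRel σ′ + count (λ p → colRel p (v , d)) σ′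
      ≡⟨ cong₂ _+_ (trans (pairs-map colRel colRel (map₁ (punchIn v)) colRel-punchIn σ) (sym (colPairs≡pairs σ)))
                   (count-map _ (map₁ (punchIn v)) σ) ⟩
    colPairs σ + count (λ p → ⌊ punchIn v (proj₁ p) <? v ⌋ ∧ ⌊ ¬? (d ≟ 0) ⌋) σ
      ≡⟨ cong (colPairs σ +_) (last-column d) ⟩
    colPairs σ + lastColPairs (v , d) ∎
    where
    open ≡-Reasoning
    colRel-punchIn : ∀ p q → colRel (map₁ (punchIn v) p) (map₁ (punchIn v) q) ≡ colRel p q
    colRel-punchIn p q = cong (_∧ _) (punchIn-<? v (proj₁ p) (proj₁ q))
    last-column : (d : ℕ) →
      count (λ p → ⌊ punchIn v (proj₁ p) <? v ⌋ ∧ ⌊ ¬? (d ≟ 0) ⌋) σ ≡ lastColPairs (v , d)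
    last-column zero    =
      trans (count-cong-∈ σ (λ {p} _ → ∧-zeroʳ ⌊ punchIn v (proj₁ p) <? v ⌋)) (count-false σ)
    last-column (suc d) = begin
      count (λ p → ⌊ punchIn v (proj₁ p) <? v ⌋ ∧ true) σ
        ≡⟨ count-cong-∈ σ (λ {p} _ → trans (∧-identityʳ _) (punchIn<v? v (proj₁ p))) ⟩
      count (λ p → ⌊ proj₁ p <? v ⌋) σ                   ≡⟨ count-map _ proj₁ σ ⟨
      count (λ x → ⌊ x <? v ⌋) π                         ≡⟨ count-↭ _ (IsColoredPerm⇒↭[] σ-perm) ⟩
      count (λ x → ⌊ x <? v ⌋) [ n ]                     ≡⟨ count-<-[] u n u≤n ⟩
      u                                                  ∎

inv-c-extend : {c n : ℕ} {σ : List (ℕ × ℕ)} {v d : ℕ} →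
  IsColoredPerm c n σ → IsLetter c (suc n) (v , d) →
  inv-c c (extend (σ , (v , d))) ≡ inv-c c σ + lastStat c n (v , d)
inv-c-extend {c} {n} {σ} {suc u} {d} σ-perm ((_ , s≤s u≤n) , _) = begin
  inv-c c (extend (σ , (suc u , d)))
    ≡⟨ cong₂ _+_ (cong₂ _+_ (inv-extend σ-perm u d) (col-extend σ-perm u d))
                 (cong (c *_) (colPairs-extend σ-perm u d u≤n)) ⟩
  (inv π + (n ∸ u)) + (col σ + d) + c * (colPairs σ + lastColPairs (suc u , d))
    ≡⟨ rearrange (inv π) (n ∸ u) (col σ) d c (colPairs σ) (lastColPairs (suc u , d)) ⟩
  inv-c c σ + lastStat c n (suc u , d) ∎
  where
  open ≡-Reasoning
  open +-*-Solver
  π = map proj₁ σ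
  rearrange : (i a l d c p k : ℕ) → (i + a) + (l + d) + c * (p + k) ≡ (i + l + c * p) + (a + d + c * k)
  rearrange = solve 7 (λ i a l d c p k →
    (i :+ a) :+ (l :+ d) :+ c :* (p :+ k) := (i :+ l :+ c :* p) :+ (a :+ d :+ c :* k)) refl

inv-c-coloredPerms-suc : (c n : ℕ) →
  map (inv-c c) (coloredPerms c (suc n)) ↭ map (inv-c c) (coloredPerms c n) ⊕ map (lastStat c n) (letters c (suc n))
inv-c-coloredPerms-suc c n = map-↭-⊕ extend (inv-c c) (inv-c c) (lastStat c n) (extend-↭ c n)
  (λ σ∈ vd∈ → inv-c-extend (∈-coloredPerms⁻ c n σ∈) (∈-letters⁻ c (suc n) vd∈))

lastStat-row : (b n u : ℕ) → u ≤ n →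
  map (lastStat (suc b) n) (map (suc u ,_) (upTo (suc b))) ≡ (n ∸ u) ∷ map (suc n +_) (map (b * u +_) (upTo b))
lastStat-row b n u u≤n = cong₂ _∷_ uncoloured-entry (begin
  map (lastStat (suc b) n) (map (suc u ,_) (applyUpTo suc b))
    ≡⟨ cong (map (lastStat (suc b) n) ∘ map (suc u ,_)) (map-upTo suc b) ⟨
  map (lastStat (suc b) n) (map (suc u ,_) (map suc (upTo b)))
    ≡⟨ trans (map-∘ (upTo b)) (map-∘ (map suc (upTo b))) ⟨
  map (λ d → n ∸ u + suc d + suc b * u) (upTo b)
    ≡⟨ map-cong coloured-entry (upTo b) ⟩
  map (λ d → suc n + (b * u + d)) (upTo b)
    ≡⟨ map-∘ (upTo b) ⟩
  map (suc n +_) (map (b * u +_) (upTo b)) ∎)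
  where
  open ≡-Reasoning
  open +-*-Solver
  uncoloured-entry : n ∸ u + 0 + suc b * 0 ≡ n ∸ u
  uncoloured-entry = trans (cong (n ∸ u + 0 +_) (*-zeroʳ b)) (trans (+-identityʳ _) (+-identityʳ _))
  coloured-entry : (d : ℕ) → n ∸ u + suc d + suc b * u ≡ suc n + (b * u + d)
  coloured-entry d = begin
    n ∸ u + suc d + suc b * u
      ≡⟨ solve 4 (λ a u b d → a :+ (con 1 :+ d) :+ (con 1 :+ b) :* u := con 1 :+ (a :+ u) :+ (b :* u :+ d))
                 refl (n ∸ u) u b d ⟩
    suc (n ∸ u + u) + (b * u + d)
      ≡⟨ cong (λ m → suc m + (b * u + d)) (m∸n+n≡m u≤n) ⟩
    suc n + (b * u + d) ∎

lastStat-↭ : (b n : ℕ) → map (lastStat (suc b) n) (letters (suc b) (suc n)) ↭ upTo (suc b * suc n)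
lastStat-↭ b n = begin
  map (lastStat c n) (concatMap (λ a → map (a ,_) (upTo c)) (map suc (upTo m)))
    ≡⟨ trans (map-concatMap (lastStat c n) (λ a → map (a ,_) (upTo c)) (map suc (upTo m)))
             (concatMap-map (λ a → map (lastStat c n) (map (a ,_) (upTo c))) suc (upTo m)) ⟩
  concatMap (λ u → map (lastStat c n) (map (suc u ,_) (upTo c))) (upTo m)
    ≡⟨ cong concat (map-cong-local (All.tabulate (λ {u} u∈ → lastStat-row b n u (≤-pred (∈-upTo⁻ u∈))))) ⟩
  concatMap (λ u → (n ∸ u) ∷ map (m +_) (row u)) (upTo m)
    ↭⟨ concatMap-∷-↭ (n ∸_) (map (m +_) ∘ row) (upTo m) ⟩
  map (n ∸_) (upTo m) ++ concatMap (map (m +_) ∘ row) (upTo m)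
    ≡⟨ cong (map (n ∸_) (upTo m) ++_) (map-concatMap (m +_) row (upTo m)) ⟨
  map (n ∸_) (upTo m) ++ map (m +_) (concatMap row (upTo m))
    ≡⟨ cong (λ xs → map (n ∸_) (upTo m) ++ map (m +_) xs) (concatMap-map _ (b *_) (upTo m)) ⟨
  map (n ∸_) (upTo m) ++ map (m +_) (concatMap (λ x → map (x +_) (upTo b)) (map (b *_) (upTo m)))
    ≡⟨ cong (λ xs → map (n ∸_) (upTo m) ++ map (m +_) xs)
            (trans (concatMap-map≡cartesianProductWith _+_ (map (b *_) (upTo m)) (upTo b)) (upTo-* b m)) ⟩
  map (n ∸_) (upTo m) ++ map (m +_) (upTo (b * m))
    ↭⟨ ↭.++⁺ʳ _ (map-∸-upTo-↭ n) ⟩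
  upTo m ++ map (m +_) (upTo (b * m))
    ≡⟨ upTo-+ m (b * m) ⟨
  upTo (c * m) ∎
  where
  open PermutationReasoning
  c = suc b
  m = suc n
  row : ℕ → List ℕ
  row u = map (b * u +_) (upTo b)

filter-map : {A B : Set} {P : B → Set} {Q : A → Set} (P? : ∀ b → Dec (P b)) (Q? : ∀ a → Dec (Q a))
  (f : A → B) → (∀ a → does (P? (f a)) ≡ does (Q? a)) →
  (xs : List A) → filter P? (map f xs) ≡ map f (filter Q? xs)
filter-map P? Q? f P∘f≡Q []       = refl
filter-map P? Q? f P∘f≡Q (x ∷ xs) with does (P? (f x)) | does (Q? x) | P∘f≡Q x
... | false | false | refl = filter-map P? Q? f P∘f≡Q xs
... | true  | true  | refl = cong (f x ∷_) (filter-map P? Q? f P∘f≡Q xs)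

uncoloured : ℕ → ℕ × ℕ
uncoloured x = x , 0

map-proj₁-uncoloured : (π : List ℕ) → map proj₁ (map uncoloured π) ≡ π
map-proj₁-uncoloured π = trans (sym (map-∘ π)) (map-id π)

coloredPerms-1 : (n : ℕ) → coloredPerms 1 n ≡ map (map uncoloured) (perms n)
coloredPerms-1 n = begin
  filter distinctEntries? (words n (concatMap (λ a → uncoloured a ∷ []) [ n ]))
    ≡⟨ cong (filter distinctEntries? ∘ words n)
            (trans (sym (concatMap-map (_∷ []) uncoloured [ n ])) (concatMap-pure _)) ⟩
  filter distinctEntries? (words n (map uncoloured [ n ]))
    ≡⟨ cong (filter distinctEntries?) (words-map uncoloured n [ n ]) ⟩
  filter distinctEntries? (map (map uncoloured) (words n [ n ]))
    ≡⟨ filter-map distinctEntries? (UniqueDec.unique? _≟_) (map uncoloured)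
         (λ π → cong (does ∘ UniqueDec.unique? _≟_) (map-proj₁-uncoloured π)) (words n [ n ]) ⟩
  map (map uncoloured) (perms n) ∎
  where open ≡-Reasoning

colPairs-uncoloured : (π : List ℕ) → colPairs (map uncoloured π) ≡ 0
colPairs-uncoloured []      = refl
colPairs-uncoloured (x ∷ π) = cong₂ _+_
  (trans (count-map _ uncoloured π)
         (trans (count-cong-∈ π (λ {y} _ → ∧-zeroʳ ⌊ x <? y ⌋)) (count-false π)))
  (colPairs-uncoloured π)

inv-c-uncoloured : (π : List ℕ) → inv-c 1 (map uncoloured π) ≡ inv π
inv-c-uncoloured π = begin
  inv (map proj₁ (map uncoloured π)) + col (map uncoloured π) + 1 * colPairs (map uncoloured π)
    ≡⟨ cong₂ _+_ (cong₂ _+_ (cong inv (map-proj₁-uncoloured π))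
                            (trans (cong sum (sym (map-∘ π))) (sum-map-zero π)))
                 (cong (1 *_) (colPairs-uncoloured π)) ⟩
  inv π + 0 + 1 * 0
    ≡⟨ trans (+-identityʳ _) (+-identityʳ (inv π)) ⟩
  inv π ∎
  where open ≡-Reasoning

map-inv-perms : (n : ℕ) → map inv (perms n) ≡ map (inv-c 1) (coloredPerms 1 n)
map-inv-perms n = begin
  map inv (perms n)                              ≡⟨ map-cong (sym ∘ inv-c-uncoloured) (perms n) ⟩
  map (inv-c 1 ∘ map uncoloured) (perms n)       ≡⟨ map-∘ (perms n) ⟩
  map (inv-c 1) (map (map uncoloured) (perms n)) ≡⟨ cong (map (inv-c 1)) (coloredPerms-1 n) ⟨
  map (inv-c 1) (coloredPerms 1 n)               ∎
  where open ≡-Reasoning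

inv-perms-suc : (n : ℕ) → map inv (perms (suc n)) ↭ map inv (perms n) ⊕ upTo (suc n)
inv-perms-suc n = begin
  map inv (perms (suc n))
    ≡⟨ map-inv-perms (suc n) ⟩
  map (inv-c 1) (coloredPerms 1 (suc n))
    ↭⟨ inv-c-coloredPerms-suc 1 n ⟩
  map (inv-c 1) (coloredPerms 1 n) ⊕ map (lastStat 1 n) (letters 1 (suc n))
    ↭⟨ ⊕-cong (↭-reflexive (sym (map-inv-perms n))) (lastStat-↭ 0 n) ⟩
  map inv (perms n) ⊕ upTo (1 * suc n)
    ≡⟨ cong (λ m → map inv (perms n) ⊕ upTo m) (*-identityˡ (suc n)) ⟩
  map inv (perms n) ⊕ upTo (suc n) ∎
  where open PermutationReasoning

inv-c-↭-inv⊕weight : (b n : ℕ) →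
  map (inv-c (suc b)) (coloredPerms (suc b) n) ↭ map inv (perms n) ⊕ map weight (words n (upTo (suc b)))
inv-c-↭-inv⊕weight b zero    = ↭-reflexive (cong (_∷ []) (*-zeroʳ b))
inv-c-↭-inv⊕weight b (suc n) = begin
  map (inv-c c) (coloredPerms c m)
    ↭⟨ inv-c-coloredPerms-suc c n ⟩
  map (inv-c c) (coloredPerms c n) ⊕ map (lastStat c n) (letters c m)
    ↭⟨ ⊕-cong (inv-c-↭-inv⊕weight b n) (lastStat-↭ b n) ⟩
  (I ⊕ W) ⊕ upTo (c * m)
    ≡⟨ cong ((I ⊕ W) ⊕_) (trans (cong upTo (*-comm c m)) (sym (upTo-* m c))) ⟩
  (I ⊕ W) ⊕ (map (m *_) (upTo c) ⊕ upTo m)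
    ↭⟨ ⊕-congʳ (I ⊕ W) (⊕-comm (map (m *_) (upTo c)) (upTo m)) ⟩
  (I ⊕ W) ⊕ (upTo m ⊕ map (m *_) (upTo c))
    ↭⟨ ⊕-interchange I W (upTo m) (map (m *_) (upTo c)) ⟩
  (I ⊕ upTo m) ⊕ (W ⊕ map (m *_) (upTo c))
    ↭⟨ ⊕-cong (↭-sym (inv-perms-suc n)) (↭-sym (weight-words-suc n (Unique.upTo⁺ c))) ⟩
  map inv (perms m) ⊕ map weight (words m (upTo c)) ∎
  where
  open PermutationReasoning
  c = suc b
  m = suc n
  I = map inv (perms n)
  W = map weight (words n (upTo c))

theorem3p5 : (n c : ℕ) → n ≥ 1 → c ≥ 1 → (k : ℕ) →
    k ≤ (c ∸ 1) * n + c * (n C 2) →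
    i-c c n k ≡ sumTo k (λ j → i n j * p≤ n (c ∸ 1) (k ∸ j))
theorem3p5 n (suc b) _ _ k _ = begin
  i-c (suc b) n k
    ≡⟨ count-map _ (inv-c (suc b)) (coloredPerms (suc b) n) ⟨
  multiplicity k (map (inv-c (suc b)) (coloredPerms (suc b) n))
    ≡⟨ count-↭ _ (inv-c-↭-inv⊕weight b n) ⟩
  multiplicity k (I ⊕ W)
    ≡⟨ multiplicity-⊕ I W k ⟩
  sumTo k (λ j → multiplicity j I * multiplicity (k ∸ j) W)
    ≡⟨ sumTo-cong k (λ j → cong₂ _*_ (count-map _ inv (perms n)) (count-map _ weight (words n (upTo (suc b))))) ⟩
  sumTo k (λ j → i n j * p≤ n b (k ∸ j)) ∎
  where
  open ≡-Reasoning
  I = map inv (perms n)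
  W = map weight (words n (upTo (suc b)))
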